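{- Let $G$ be a graph and $H$ a subgraph of $G$ with $V(H)=V(G)$. If $\gamma(H)=\gamma(G)$, then $\tau(H)\le\tau(G)$.
   Context: All graphs are finite, simple and undirected. A set $D\subseteq V(G)$ is a dominating set of $G$ if every vertex not in $D$ is adjacent to at least one vertex of $D$. The domination number $\gamma(G)$ is the minimum cardinality of a dominating set; a dominating set of cardinality $\gamma(G)$ is a $\gamma(G)$-set. $\tau(G)$ denotes the total number of $\gamma(G)$-sets. -}

module Defs where

open import Data.Bool using (Bool; true; false; _∧_; _∨_; not; if_then_else_)
open import Data.Nat using (ℕ; zero; suc; _⊓_; _+_)
open import Data.Fin using (Fin)
open import Data.Vec using (Vec; []; _∷_; lookup)
open import Data.List using (List; []; _∷_; map; _++_; filter; length; foldr)
open import Data.List.Base using (allFin)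
open import Data.Fin.Subset using (Subset; _∈_; ∣_∣)
open import Relation.Binary.PropositionalEquality using (_≡_)
open import Relation.Nullary using (¬_)
open import Relation.Nullary.Decidable using (Dec; yes; no)

record Graph (n : ℕ) : Set where
  field
    adj   : Fin n → Fin n → Bool
    sym   : ∀ u v → adj u v ≡ adj v u
    irrfl : ∀ v → adj v v ≡ false
open Graph public

_⊑_ : ∀ {n} → Graph n → Graph n → Set
H ⊑ G = ∀ u v → adj H u v ≡ true → adj G u v ≡ true

anyᵇ : ∀ {n} → (Fin n → Bool) → Bool
anyᵇ {n} p = foldr (λ i b → p i ∨ b) false (allFin n)

allᵇ : ∀ {n} → (Fin n → Bool) → Bool
allᵇ {n} p = foldr (λ i b → p i ∧ b) true (allFin n)

isDominatingᵇ : ∀ {n} → Graph n → Subset n → Bool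
isDominatingᵇ G D =
  allᵇ (λ v → lookup D v ∨ anyᵇ (λ u → lookup D u ∧ adj G v u))

IsDominating : ∀ {n} → Graph n → Subset n → Set
IsDominating G D = isDominatingᵇ G D ≡ true

allSubsets : (n : ℕ) → List (Subset n)
allSubsets zero = [] ∷ []
allSubsets (suc n) = map (true ∷_) (allSubsets n) ++ map (false ∷_) (allSubsets n)

dominatingSets : ∀ {n} → Graph n → List (Subset n)
dominatingSets {n} G = filter (λ D → isDom D) (allSubsets n)
  where
  isDom : (D : Subset n) → Dec (isDominatingᵇ G D ≡ true)
  isDom D with isDominatingᵇ G D
  ... | true  = yes _≡_.refl
  ... | false = no (λ ())

-- Domination number: minimum cardinality of a dominating set
-- (V(G) is always dominating, so the minimum is over a nonempty family).
γ : ∀ {n} → Graph n → ℕ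
γ {n} G = foldr (λ D m → ∣ D ∣ ⊓ m) n (dominatingSets G)

τ : ∀ {n} → Graph n → ℕ
τ {n} G = length (filter (λ D → ∣ D ∣ Data.Nat.≟ γ G) (dominatingSets G))

-- Adding edges keeps a set dominating, so the enumeration of dominating sets of H
-- is a sublist of that of G; when γ(H) = γ(G) the same filter by size selects the
-- γ-sets on both sides, hence the γ(H)-sets form a sublist of the γ(G)-sets.
module Submission where

open import Defs
open import Data.Bool using (Bool; true; false; _∧_; _∨_)
open import Data.Bool.Properties using (∨-zeroʳ)
open import Data.List using (List; []; _∷_; allFin; foldr)
open import Data.List.Relation.Binary.Sublist.Propositional using (_⊆_; ⊆-refl)
open import Data.List.Relation.Binary.Sublist.Propositional.Properties
  using (filter⁺; length-mono-≤)
open import Data.Nat using (ℕ; _≤_)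
open import Data.Vec using (lookup)
open import Data.Fin using (Fin)
open import Relation.Binary.PropositionalEquality using (_≡_; refl; trans)

_⇒ᵇ_ : {A : Set} → (A → Bool) → (A → Bool) → Set
p ⇒ᵇ q = ∀ i → p i ≡ true → q i ≡ true

foldr-∧-mono : {A : Set} {p q : A → Bool} → p ⇒ᵇ q → (xs : List A) →
  foldr (λ i b → p i ∧ b) true xs ≡ true →
  foldr (λ i b → q i ∧ b) true xs ≡ true
foldr-∧-mono p⇒q []       _ = refl
foldr-∧-mono {p = p} p⇒q (x ∷ xs) e with p x in px
... | true  rewrite p⇒q x px = foldr-∧-mono p⇒q xs e
... | false with () ← e

foldr-∨-mono : {A : Set} {p q : A → Bool} → p ⇒ᵇ q → (xs : List A) →
  foldr (λ i b → p i ∨ b) false xs ≡ true →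
  foldr (λ i b → q i ∨ b) false xs ≡ true
foldr-∨-mono p⇒q [] ()
foldr-∨-mono {p = p} {q} p⇒q (x ∷ xs) e with p x in px
... | true  rewrite p⇒q x px = refl
... | false rewrite foldr-∨-mono p⇒q xs e = ∨-zeroʳ (q x)

allᵇ-mono : ∀ {n} {p q : Fin n → Bool} → p ⇒ᵇ q → allᵇ p ≡ true → allᵇ q ≡ true
allᵇ-mono {n} p⇒q = foldr-∧-mono p⇒q (allFin n)

anyᵇ-mono : ∀ {n} {p q : Fin n → Bool} → p ⇒ᵇ q → anyᵇ p ≡ true → anyᵇ q ≡ true
anyᵇ-mono {n} p⇒q = foldr-∨-mono p⇒q (allFin n)

isDominating-mono : ∀ {n} (G H : Graph n) → H ⊑ G → ∀ D → IsDominating H D → IsDominating G D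
isDominating-mono G H H⊑G D = allᵇ-mono dominated-mono
  where
  neighbour-mono : ∀ v → (λ u → lookup D u ∧ adj H v u) ⇒ᵇ (λ u → lookup D u ∧ adj G v u)
  neighbour-mono v u e with lookup D u
  ... | true = H⊑G v u e

  dominated-mono : (λ v → lookup D v ∨ anyᵇ (λ u → lookup D u ∧ adj H v u))
                ⇒ᵇ (λ v → lookup D v ∨ anyᵇ (λ u → lookup D u ∧ adj G v u))
  dominated-mono v e with lookup D v
  ... | true  = refl
  ... | false = anyᵇ-mono (neighbour-mono v) e

dominatingSets-⊆ : ∀ {n} (G H : Graph n) → H ⊑ G → dominatingSets H ⊆ dominatingSets G
dominatingSets-⊆ {n} G H H⊑G =
  filter⁺ _ _ (λ { {D} refl → isDominating-mono G H H⊑G D }) (⊆-refl {x = allSubsets n})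

proposition2p6 : ∀ {n : ℕ} (G H : Graph n) → H ⊑ G → γ H ≡ γ G → τ H ≤ τ G
proposition2p6 G H H⊑G γH≡γG =
  length-mono-≤ (filter⁺ _ _ (λ { refl size≡γH → trans size≡γH γH≡γG }) (dominatingSets-⊆ G H H⊑G))
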